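{- Let $\langle\mathcal S,\mathcal D,\mathcal C\rangle$ be admissible with $\mathcal D$ existentially expressible in $\mathcal C$, let $\mathcal P$ be a $\mathrm{SQCLP}(\mathcal S,\mathcal D,\mathcal C)$-program and $G$ a goal for $\mathcal P$ all of whose atoms are relevant for $\mathcal P$, and let $\mathcal P'=\mathrm{elim}_{\mathcal S}(\mathcal P)$, $G'=\mathrm{elim}_{\mathcal S}(G)$, $\mathcal P''=\mathrm{elim}_{\mathcal D}(\mathcal P')$, $G''=\mathrm{elim}_{\mathcal D}(G')$. Let $\langle\sigma',\Pi\rangle\in\mathrm{Sol}_{\mathcal P''}(G'')$, $\nu\in\mathrm{Sol}_{\mathcal C}(\Pi)$ and $\theta=\sigma'\nu$. Then $\langle\theta,\Pi\rangle\in\mathrm{Sol}_{\mathcal P''}(G'')$, and $W\theta\in\mathrm{ran}(\iota)$ for every $W\in\mathrm{var}(G'')\setminus\mathrm{var}(G)$.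
   Context: Constraint domains: ranked disjoint sets $DC$ (data constructors), $DP$ (defined predicates), $PP$ (primitive predicates); $\mathcal C$ has basic values $B_{\mathcal C}$ and carrier $C_{\mathcal C}$ of ground terms over basic values and data constructors. Atoms: defined $p(\bar t)$, primitive $\kappa=r(\bar t)$, equations $t==s$ (latter two atomic constraints). $\mathrm{Sol}_{\mathcal C}(\Pi)$ = ground valuations making $\Pi$ true; $\Pi\models_{\mathcal C}\pi$ iff $\mathrm{Sol}_{\mathcal C}(\Pi)\subseteq\mathrm{Sol}_{\mathcal C}(\pi)$; satisfiable iff nonempty. Qualification domain $\mathcal D=\langle D,\sqsubseteq,\mathbf b,\mathbf t,\circ\rangle$: lattice with bottom $\mathbf b$, top $\mathbf t$, glb $\sqcap$; $\circ$ associative, commutative, monotonic, $d\circ\mathbf t=d$, $d\circ\mathbf b=\mathbf b$, $d\circ e\sqsubseteq e$, $d\circ(e_1\sqcap e_2)=(d\circ e_1)\sqcap(d\circ e_2)$. $D^*=D\setminus\{\mathbf b\}$, $D^?=D^*\cup\{?\}$; $e\sqsupseteq^?w$ is $e\sqsupseteq w$ if $w\ne?$, true otherwise. Admissible triple: $\mathcal S:S\times S\to D$ ($S$ = variables, basic values, signature symbols) reflexive with value $\mathbf t$, symmetric, $\mathcal S(X,Y)=\mathbf b$ for distinct variables, $\mathcal S(x,y)\ne\mathbf b$ only if $x=y$ or both basic values, both data constructors of equal arity, or both defined predicates of equal arity. Predicate $p$ is affected by $\mathcal P$ if $\mathcal S(p,p')\neq\mathbf b$ for some $p'$ occurring in $\mathcal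 P$; an atom is relevant for $\mathcal P$ if it is an equation, primitive, or a defined atom with affected predicate. Expressibility: injective $\iota:D^*\to C_{\mathcal C}$, constraint $\mathrm{qval}(X)$ with solutions exactly the valuations with $\eta(X)\in\mathrm{ran}(\iota)$, constraint $\mathrm{qbound}(X,Y,Z)$ solved by $X,Y,Z\mapsto\iota(x),\iota(y),\iota(z)$ iff $x\sqsubseteq y\circ z$; existential: $\mathrm{qval}(X)=\exists\bar U(B_1\wedge\dots\wedge B_m)$, $\mathrm{qbound}(X,Y,Z)=\exists\bar V(C_1\wedge\dots\wedge C_q)$ with atomic conjuncts. $E_{\mathcal D}=\{qVal(X)\gets B_1,\dots,B_m;\ qBound(X,Y,Z)\gets C_1,\dots,C_q\}$, with fresh $qVal,qBound$. Programs: (S)QCLP clauses $p(t_1,\dots,t_n)\xleftarrow{\alpha}B_1\#w_1,\dots,B_m\#w_m$ ($\alpha\in D^*$, $w_j\in D^?$); CLP clauses $p(\bar t)\gets B_1,\dots,B_m$. $\mathrm{CHL}(\mathcal C)$: (DA) from $(t'_i==t_i\theta)\Leftarrow\Pi$ and $B_j\theta\Leftarrow\Pi$ infer $p(t'_1,\dots,t'_n)\Leftarrow\Pi$ for a program clause $p(t_1,\dots,t_n)\gets B_1,\dots,B_m$ and substitution $\theta$; (EA) infer $(t==s)\Leftarrow\Pi$ if $\Pi\models_{\mathcal C}t==s$; (PA) infer $\kappa\Leftarrow\Pi$ if $\Pi\models_{\mathcal C}\kappa$. A CLP goal is a conjunction of atoms; $\mathrm{Sol}_{\mathcal P''}(G'')$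 is the set of pairs $\langle\theta,\Pi\rangle$ ($\theta$ a $\mathcal C$-substitution, $\Pi$ satisfiable finite set of atomic constraints) with $\mathcal P''\vdash_{\mathrm{CHL}}A\theta\Leftarrow\Pi$ for every atom $A$ of $G''$. SQCLP goals: $G:A_1\#W_1,\dots,A_m\#W_m\,\|\,W_1\sqsupseteq^?\beta_1,\dots,W_m\sqsupseteq^?\beta_m$ with pairwise distinct qualification variables $W_i$ (disjoint from data variables), $\beta_i\in D^?$; $\mathrm{var}(G)$ are its data variables; $\mathrm{var}(G'')$ all variables of the CLP goal $G''$ (including the former qualification variables). $\mathrm{elim}_{\mathcal S}$: $A_\sim$ is $t\sim s$ if $A$ is $t==s$, else $A$. $\mathrm{elim}_{\mathcal S}(\mathcal P)$ consists of $EQ_{\mathcal S}$: $X\sim Y\xleftarrow{\mathbf t}(X==Y)\#?$; $u\sim u'\xleftarrow{\mathbf t}\mathrm{pay}_\lambda\#?$ for $u,u'\in B_{\mathcal C}$, $\mathcal S(u,u')=\lambda\neq\mathbf b$; $c(X_1,\dots,X_n)\sim c'(Y_1,\dots,Y_n)\xleftarrow{\mathbf t}\mathrm{pay}_\lambda\#?,(X_i\sim Y_i)\#?_{i=1..n}$ for $c,c'\in DC^n$, $\mathcal S(c,c')=\lambda\neq\mathbf b$; $\mathrm{pay}_\lambda\xleftarrow{\lambda}$ for each value $\lambda=\mathcal S(x,y)\neq\mathbf b$; and, for each clause $C:p(t_1,\dots,t_n)\xleftarrow{\alpha}B_1\#w_1,\dots,B_m\#w_m$ of $\mathcal P$, the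 clause $\hat p_C(t_1,\dots,t_n)\xleftarrow{\alpha}(B_1)_\sim\#w_1,\dots,(B_m)_\sim\#w_m$ (new predicate $\hat p_C$, distinct per clause, not affected by $\mathcal P$) plus, for each $p'\in DP^n$ with $\mathcal S(p,p')=\lambda\neq\mathbf b$, $p'(X_1,\dots,X_n)\xleftarrow{\mathbf t}\mathrm{pay}_\lambda\#?,(X_i\sim t_i)\#?_{i=1..n},\hat p_C(t_1,\dots,t_n)\#?$ with fresh distinct $X_i$. $\mathrm{elim}_{\mathcal S}(G)$ replaces each $A_i$ by $(A_i)_\sim$. $\mathrm{elim}_{\mathcal D}$: rename each $p\in DP^n$ to distinct $p'\in DP^{n+1}$; $\tau(t==s)=(t==s,\iota(\mathbf t))$, $\tau(\kappa)=(\kappa,\iota(\mathbf t))$, $\tau(p(\bar t))=(p'(\bar t,W),W)$ with $W$ fresh; for a clause $C:p(\bar t)\xleftarrow{\alpha}B_1\#w_1,\dots,B_m\#w_m$ with $\tau(B_j)=(B'_j,w'_j)$, $\tau(C)=p'(\bar t,W)\gets qVal(W),(qVal(w'_j),[w'_j\sqsupseteq^?\iota(w_j)],qBound(W,\iota(\alpha),w'_j),B'_j)_{j}$ ($W$ fresh; bracket omitted if $w_j=?$, otherwise $qBound(\iota(w_j),\iota(\mathbf t),w'_j)$); $\mathrm{elim}_{\mathcal D}(\mathcal P')=E_{\mathcal D}\cup\{\tau(C):C\in\mathcal P'\}$. For a goal $B_1\#W_1,\dots,B_m\#W_m\,\|\,W_j\sqsupseteq^?\beta_j$ with $\tau(B_j)=(B'_j,w'_j)$,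 $\mathrm{elim}_{\mathcal D}$ gives the CLP goal $(qVal(W_j),[W_j\sqsupseteq^?\iota(\beta_j)],qVal(w'_j),qBound(W_j,\iota(\mathbf t),w'_j),B'_j)_{j}$, bracket omitted if $\beta_j=?$ and otherwise $qBound(\iota(\beta_j),\iota(\mathbf t),W_j)$. -}

module Defs where

open import Data.Nat using (ℕ; zero; suc)
open import Data.Fin using (Fin)
open import Data.Vec as Vec using (Vec; []; _∷_; lookup; _∷ʳ_; toList)
open import Data.List as List using (List; []; _∷_; _++_; concatMap; length)
open import Data.List.Membership.Propositional using (_∈_; _∉_)
open import Data.List.Relation.Unary.All using (All)
open import Data.List.Relation.Unary.Unique.Propositional using (Unique)
open import Data.Product using (Σ; ∃; _×_; _,_; proj₁; proj₂)
open import Data.Sum using (_⊎_)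
open import Data.Maybe using (Maybe; just; nothing)
open import Data.Empty using (⊥; ⊥-elim)
open import Data.Unit using (⊤)
open import Function.Bundles using (_⇔_)
open import Relation.Binary.PropositionalEquality using (_≡_; _≢_)

-- Terms over basic values BV and ranked data constructors DC,
-- with variables drawn from V.  Ground terms: V = ⊥.

data TermOver (BV : Set) (DC : ℕ → Set) (V : Set) : Set where
  var : V → TermOver BV DC V
  val : BV → TermOver BV DC V
  con : ∀ {n} → DC n → Vec (TermOver BV DC V) n → TermOver BV DC V

-- A constraint domain C over a signature ⟨DC, DP, PP⟩ (ranked families).
-- Carrier C_C = ground terms over basic values and data constructors.

record ConstraintDomain : Set₁ where
  field
    BV     : Set
    DC     : ℕ → Set
    DP     : ℕ → Set
    PP     : ℕ → Set
    interp : ∀ {n} → PP n → Vec (TermOver BV DC ⊥) n → Set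

record QualDomain : Set₁ where
  infix 4 _⊑_
  infixl 7 _∘_
  field
    D         : Set
    _⊑_       : D → D → Set
    ⊑-refl    : ∀ {d} → d ⊑ d
    ⊑-trans   : ∀ {c d e} → c ⊑ d → d ⊑ e → c ⊑ e
    ⊑-antisym : ∀ {d e} → d ⊑ e → e ⊑ d → d ≡ e
    𝐛 𝐭       : D
    𝐛-least   : ∀ d → 𝐛 ⊑ d
    𝐭-great   : ∀ d → d ⊑ 𝐭
    𝐭≢𝐛       : 𝐭 ≢ 𝐛
    _⊓_ _⊔_   : D → D → D
    ⊓-lb₁     : ∀ d e → d ⊓ e ⊑ d
    ⊓-lb₂     : ∀ d e → d ⊓ e ⊑ e
    ⊓-glb     : ∀ {c d e} → c ⊑ d → c ⊑ e → c ⊑ d ⊓ e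
    ⊔-ub₁     : ∀ d e → d ⊑ d ⊔ e
    ⊔-ub₂     : ∀ d e → e ⊑ d ⊔ e
    ⊔-lub     : ∀ {c d e} → d ⊑ c → e ⊑ c → d ⊔ e ⊑ c
    _∘_       : D → D → D
    ∘-assoc   : ∀ d e f → (d ∘ e) ∘ f ≡ d ∘ (e ∘ f)
    ∘-comm    : ∀ d e → d ∘ e ≡ e ∘ d
    ∘-mono    : ∀ {d d′ e e′} → d ⊑ d′ → e ⊑ e′ → d ∘ e ⊑ d′ ∘ e′
    ∘-𝐭       : ∀ d → d ∘ 𝐭 ≡ d
    ∘-𝐛       : ∀ d → d ∘ 𝐛 ≡ 𝐛
    ∘-⊑       : ∀ d e → d ∘ e ⊑ e
    ∘-⊓       : ∀ d e₁ e₂ → d ∘ (e₁ ⊓ e₂) ≡ (d ∘ e₁) ⊓ (d ∘ e₂)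

module Syntax (CD : ConstraintDomain) where
  open ConstraintDomain CD

  Term : Set
  Term = TermOver BV DC ℕ

  GTerm : Set
  GTerm = TermOver BV DC ⊥

  infixl 8 _⟨_⟩ _⟨_⟩*
  mutual
    _⟨_⟩ : ∀ {V W} → TermOver BV DC V → (V → TermOver BV DC W) → TermOver BV DC W
    var x    ⟨ σ ⟩ = σ x
    val u    ⟨ σ ⟩ = val u
    con c ts ⟨ σ ⟩ = con c (ts ⟨ σ ⟩*)

    _⟨_⟩* : ∀ {V W n} → Vec (TermOver BV DC V) n → (V → TermOver BV DC W) → Vec (TermOver BV DC W) n
    []       ⟨ σ ⟩* = []
    (t ∷ ts) ⟨ σ ⟩* = t ⟨ σ ⟩ ∷ ts ⟨ σ ⟩*

  ⌜_⌝ : GTerm → Term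
  ⌜ t ⌝ = t ⟨ ⊥-elim ⟩

  mutual
    varsT : Term → List ℕ
    varsT (var x)    = x ∷ []
    varsT (val u)    = []
    varsT (con c ts) = varsT* ts

    varsT* : ∀ {n} → Vec Term n → List ℕ
    varsT* []       = []
    varsT* (t ∷ ts) = varsT t ++ varsT* ts

  infix 6 _==_
  data ACon : Set where
    prim : ∀ {n} → PP n → Vec Term n → ACon
    _==_ : Term → Term → ACon

  data Atom (Pr : ℕ → Set) : Set where
    def : ∀ {n} → Pr n → Vec Term n → Atom Pr
    cn  : ACon → Atom Pr

  varsC : ACon → List ℕ
  varsC (prim r ts) = varsT* ts
  varsC (t == s)    = varsT t ++ varsT s

  varsA : ∀ {Pr} → Atom Pr → List ℕ
  varsA (def p ts) = varsT* ts
  varsA (cn c)     = varsC c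

  Subst : Set
  Subst = ℕ → Term

  substC : Subst → ACon → ACon
  substC θ (prim r ts) = prim r (ts ⟨ θ ⟩*)
  substC θ (t == s)    = t ⟨ θ ⟩ == s ⟨ θ ⟩

  substA : ∀ {Pr} → Subst → Atom Pr → Atom Pr
  substA θ (def p ts) = def p (ts ⟨ θ ⟩*)
  substA θ (cn c)     = cn (substC θ c)

  Valuation : Set
  Valuation = ℕ → GTerm

  holds : ACon → Valuation → Set
  holds (prim r ts) η = interp r (ts ⟨ η ⟩*)
  holds (t == s)    η = t ⟨ η ⟩ ≡ s ⟨ η ⟩

  SolC : List ACon → Valuation → Set
  SolC Π η = All (λ c → holds c η) Π

  _⊨_ : List ACon → ACon → Set
  Π ⊨ π = ∀ η → SolC Π η → holds π η

  Satisfiable : List ACon → Set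
  Satisfiable Π = ∃ λ η → SolC Π η

  _·_ : Subst → Valuation → Subst
  (σ · ν) X = ⌜ σ X ⟨ ν ⟩ ⌝

  record Clause (Pr : ℕ → Set) : Set where
    constructor clause
    field
      arity : ℕ
      hd    : Pr arity
      args  : Vec Term arity
      body  : List (Atom Pr)

  data Derives {Pr : ℕ → Set} (Prog : Clause Pr → Set) : Atom Pr → List ACon → Set where
    DA : ∀ {Π} (C : Clause Pr) → Prog C → (θ : Subst)
         (ts′ : Vec Term (Clause.arity C)) →
         (∀ i → Derives Prog (cn (lookup ts′ i == (lookup (Clause.args C) i) ⟨ θ ⟩)) Π) →
         (∀ B → B ∈ Clause.body C → Derives Prog (substA θ B) Π) →
         Derives Prog (def (Clause.hd C) ts′) Π
    EA : ∀ {Π t s} → Π ⊨ (t == s) → Derives Prog (cn (t == s)) Π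
    PA : ∀ {Π n} {r : PP n} {ts} → Π ⊨ prim r ts → Derives Prog (cn (prim r ts)) Π

  CGoal : (ℕ → Set) → Set
  CGoal Pr = List (Atom Pr)

  varsCGoal : ∀ {Pr} → CGoal Pr → List ℕ
  varsCGoal = concatMap varsA

  SolP : ∀ {Pr} → (Clause Pr → Set) → CGoal Pr → Subst → List ACon → Set
  SolP Prog G θ Π = Satisfiable Π × All (λ A → Derives Prog (substA θ A) Π) G

module Theory (CD : ConstraintDomain) (QD : QualDomain) where
  open ConstraintDomain CD
  open QualDomain QD
  open Syntax CD

  D* : Set
  D* = Σ D (λ d → d ≢ 𝐛)

  D? : Set                          -- nothing plays the role of ‘?’
  D? = Maybe D*

  𝐭* : D*
  𝐭* = 𝐭 , 𝐭≢𝐛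

  record QClause (Pr : ℕ → Set) : Set where
    constructor qclause
    field
      arity : ℕ
      hd    : Pr arity
      args  : Vec Term arity
      α     : D*
      body  : List (Atom Pr × D?)

  varsQ : ∀ {Pr} → QClause Pr → List ℕ
  varsQ C = varsT* (QClause.args C) ++ concatMap (λ b → varsA (proj₁ b)) (QClause.body C)

  -- SQCLP goals  A₁#W₁,…,Aₘ#Wₘ ‖ W₁ ⊒? β₁,…,Wₘ ⊒? βₘ  as lists of (Aᵢ , Wᵢ , βᵢ)
  QGoal : (ℕ → Set) → Set
  QGoal Pr = List (Atom Pr × ℕ × D?)

  dataVarsG : ∀ {Pr} → QGoal Pr → List ℕ
  dataVarsG = concatMap (λ g → varsA (proj₁ g))

  qualVarsG : ∀ {Pr} → QGoal Pr → List ℕ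
  qualVarsG = List.map (λ g → proj₁ (proj₂ g))

  WellFormedGoal : ∀ {Pr} → QGoal Pr → Set
  WellFormedGoal G = Unique (qualVarsG G) × All (_∉ dataVarsG G) (qualVarsG G)

  -- S is given on pairs of basic values,
  -- of data constructors of equal arity and of defined predicates of equal
  -- arity; all other pairs of distinct symbols/variables get 𝐛, and every
  -- symbol/variable is 𝐭-similar to itself.

  record Admissible : Set where
    field
      SB      : BV → BV → D
      SDC     : ∀ {n} → DC n → DC n → D
      SDP     : ∀ {n} → DP n → DP n → D
      SB-refl  : ∀ u → SB u u ≡ 𝐭
      SDC-refl : ∀ {n} (c : DC n) → SDC c c ≡ 𝐭
      SDP-refl : ∀ {n} (p : DP n) → SDP p p ≡ 𝐭
      SB-sym   : ∀ u v → SB u v ≡ SB v u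
      SDC-sym  : ∀ {n} (c c′ : DC n) → SDC c c′ ≡ SDC c′ c
      SDP-sym  : ∀ {n} (p p′ : DP n) → SDP p p′ ≡ SDP p′ p

  record ExistExpressible : Set where
    field
      ι        : D* → GTerm
      ι-inj    : ∀ {x y} → ι x ≡ ι y → x ≡ y
      -- qval(X) = ∃Ū (B₁ ∧ … ∧ Bₘ)
      qvX      : ℕ
      qvalBody : List ACon
      qvalSpec : ∀ (η : Valuation) →
                 (∃ λ η′ → η′ qvX ≡ η qvX × SolC qvalBody η′) ⇔ (∃ λ d → η qvX ≡ ι d)
      -- qbound(X,Y,Z) = ∃V̄ (C₁ ∧ … ∧ C_q)
      qbX qbY qbZ : ℕ
      qbXY : qbX ≢ qbY
      qbXZ : qbX ≢ qbZ
      qbYZ : qbY ≢ qbZ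
      qboundBody : List ACon
      qboundSpec : ∀ (η : Valuation) (x y z : D*) →
                   η qbX ≡ ι x → η qbY ≡ ι y → η qbZ ≡ ι z →
                   (∃ λ η′ → η′ qbX ≡ η qbX × η′ qbY ≡ η qbY × η′ qbZ ≡ η qbZ
                             × SolC qboundBody η′)
                   ⇔ (proj₁ x ⊑ proj₁ y ∘ proj₁ z)

  data DP′ : ℕ → Set where
    orig : ∀ {n} → DP n → DP′ n
    sim  : DP′ 2
    pay  : D → DP′ 0
    hat  : (C : QClause DP) → DP′ (QClause.arity C)

  predsA : Atom DP → List (Σ ℕ DP)
  predsA (def {n} p ts) = (n , p) ∷ []
  predsA (cn c)         = []

  predsQ : QClause DP → List (Σ ℕ DP)
  predsQ C = (QClause.arity C , QClause.hd C) ∷ concatMap (λ b → predsA (proj₁ b)) (QClause.body C)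

  predsP : List (QClause DP) → List (Σ ℕ DP)
  predsP = concatMap predsQ

  _≈_ : Term → Term → Atom DP′
  t ≈ s = def sim (t ∷ s ∷ [])

  _∼A : Atom DP → Atom DP′
  def p ts ∼A       = def (orig p) ts
  cn (prim r ts) ∼A = cn (prim r ts)
  cn (t == s) ∼A    = t ≈ s

  elimSBody : List (Atom DP × D?) → List (Atom DP′ × D?)
  elimSBody = List.map (λ b → (proj₁ b ∼A) , proj₂ b)

  hatClause : QClause DP → QClause DP′
  hatClause C = qclause (QClause.arity C) (hat C) (QClause.args C) (QClause.α C)
                        (elimSBody (QClause.body C))

  elimSGoal : QGoal DP → QGoal DP′
  elimSGoal = List.map (λ g → (proj₁ g ∼A) , proj₂ g)

  module ElimS (S : Admissible) where
    open Admissible S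

    SValue : D → Set
    SValue l = (l ≡ 𝐭)
             ⊎ (∃ λ u → ∃ λ v → SB u v ≡ l)
             ⊎ (∃ λ n → ∃ λ (c : DC n) → ∃ λ c′ → SDC c c′ ≡ l)
             ⊎ (∃ λ n → ∃ λ (p : DP n) → ∃ λ p′ → SDP p p′ ≡ l)

    Affected : ∀ {n} → List (QClause DP) → DP n → Set
    Affected {n} P p = ∃ λ (p′ : DP n) → (n , p′) ∈ predsP P × SDP p p′ ≢ 𝐛

    Relevant : List (QClause DP) → Atom DP → Set
    Relevant P (def p ts) = Affected P p
    Relevant P (cn c)     = ⊤

    payA : D → Atom DP′
    payA l = def (pay l) []

    -- elim_S(P), as a set of clauses (closed under choice of the fresh variables)
    data ElimS (P : List (QClause DP)) : QClause DP′ → Set where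
      eq-var : ∀ (X Y : ℕ) → X ≢ Y →
        ElimS P (qclause 2 sim (var X ∷ var Y ∷ []) 𝐭* ((cn (var X == var Y) , nothing) ∷ []))
      eq-val : ∀ (u u′ : BV) → SB u u′ ≢ 𝐛 →
        ElimS P (qclause 2 sim (val u ∷ val u′ ∷ []) 𝐭* ((payA (SB u u′) , nothing) ∷ []))
      eq-con : ∀ {n} (c c′ : DC n) → SDC c c′ ≢ 𝐛 → (Xs Ys : Vec ℕ n) →
        Unique (toList Xs ++ toList Ys) →
        ElimS P (qclause 2 sim (con c (Vec.map var Xs) ∷ con c′ (Vec.map var Ys) ∷ []) 𝐭*
                   ((payA (SDC c c′) , nothing)
                    ∷ toList (Vec.zipWith (λ X Y → (var X ≈ var Y) , nothing) Xs Ys)))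
      pay-cl : ∀ (l : D) (nb : l ≢ 𝐛) → SValue l →
        ElimS P (qclause 0 (pay l) [] (l , nb) [])
      hat-cl : ∀ (C : QClause DP) → C ∈ P → ElimS P (hatClause C)
      sim-cl : ∀ (C : QClause DP) → C ∈ P → (p′ : DP (QClause.arity C)) →
        SDP (QClause.hd C) p′ ≢ 𝐛 →
        (Xs : Vec ℕ (QClause.arity C)) → Unique (toList Xs) → All (_∉ varsQ C) (toList Xs) →
        ElimS P (qclause (QClause.arity C) (orig p′) (Vec.map var Xs) 𝐭*
                   ((payA (SDP (QClause.hd C) p′) , nothing)
                    ∷ (toList (Vec.zipWith (λ X t → (var X ≈ t) , nothing) Xs (QClause.args C))
                       ++ ((def (hat C) (QClause.args C) , nothing) ∷ []))))

  data Ext (Pr : ℕ → Set) : ℕ → Set where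
    ren    : ∀ {n} → Pr n → Ext Pr (suc n)
    qVal   : Ext Pr 1
    qBound : Ext Pr 3

  module ElimD (E : ExistExpressible) where
    open ExistExpressible E

    ιt : Term
    ιt = ⌜ ι 𝐭* ⌝

    qValA : ∀ {Pr} → Term → Atom (Ext Pr)
    qValA t = def qVal (t ∷ [])

    qBoundA : ∀ {Pr} → Term → Term → Term → Atom (Ext Pr)
    qBoundA x y z = def qBound (x ∷ y ∷ z ∷ [])

    -- τ, with the fresh variable W supplied as an argument
    τ : ∀ {Pr} → Atom Pr → ℕ → Atom (Ext Pr) × Term
    τ (def p ts) W = def (ren p) (ts ∷ʳ var W) , var W
    τ (cn c)     W = cn c , ιt

    liftC : ∀ {Pr} → ACon → Atom (Ext Pr)
    liftC = cn

    qValClause : ∀ {Pr} → Clause (Ext Pr)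
    qValClause = clause 1 qVal (var qvX ∷ []) (List.map liftC qvalBody)

    qBoundClause : ∀ {Pr} → Clause (Ext Pr)
    qBoundClause = clause 3 qBound (var qbX ∷ var qbY ∷ var qbZ ∷ []) (List.map liftC qboundBody)

    τBodyAtom : ∀ {Pr} → D* → Term → (Atom Pr × D?) × ℕ → List (Atom (Ext Pr))
    τBodyAtom α W ((B , w) , Wj) with τ B Wj
    ... | (B′ , w′) = qValA w′ ∷ (bnd w ++ (qBoundA W ⌜ ι α ⌝ w′ ∷ B′ ∷ []))
      where
        bnd : D? → List (Atom _)
        bnd nothing  = []
        bnd (just d) = qBoundA ⌜ ι d ⌝ ιt w′ ∷ []

    τC : ∀ {Pr} (C : QClause Pr) → ℕ → Vec ℕ (length (QClause.body C)) → Clause (Ext Pr)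
    τC C W Ws = clause (suc (QClause.arity C)) (ren (QClause.hd C)) (QClause.args C ∷ʳ var W)
                  (qValA (var W) ∷ concatMap (τBodyAtom (QClause.α C) (var W))
                                             (List.zip (QClause.body C) (toList Ws)))

    -- elim_D(P′) = E_D ∪ {τ(C) : C ∈ P′}  (closed under choice of fresh variables)
    data ElimD {Pr : ℕ → Set} (P′ : QClause Pr → Set) : Clause (Ext Pr) → Set where
      eD-qVal   : ElimD P′ qValClause
      eD-qBound : ElimD P′ qBoundClause
      eD-τ      : ∀ (C : QClause Pr) → P′ C → (W : ℕ) (Ws : Vec ℕ (length (QClause.body C))) →
                  Unique (W ∷ toList Ws) → All (_∉ varsQ C) (W ∷ toList Ws) →
                  ElimD P′ (τC C W Ws)

    τGoalAtom : ∀ {Pr} → (Atom Pr × ℕ × D?) × ℕ → List (Atom (Ext Pr))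
    τGoalAtom ((B , W , β) , W′) with τ B W′
    ... | (B′ , w′) = qValA (var W) ∷ (bnd β ++ (qValA w′ ∷ qBoundA (var W) ιt w′ ∷ B′ ∷ []))
      where
        bnd : D? → List (Atom _)
        bnd nothing  = []
        bnd (just d) = qBoundA ⌜ ι d ⌝ ιt (var W) ∷ []

    elimDGoalWith : ∀ {Pr} (G : QGoal Pr) → Vec ℕ (length G) → CGoal (Ext Pr)
    elimDGoalWith G Ws = concatMap τGoalAtom (List.zip G (toList Ws))

    IsElimDGoal : ∀ {Pr} → QGoal Pr → CGoal (Ext Pr) → Set
    IsElimDGoal G′ G″ = ∃ λ (Ws : Vec ℕ (length G′)) →
        Unique (toList Ws) × All (_∉ (dataVarsG G′ ++ qualVarsG G′)) (toList Ws)
        × G″ ≡ elimDGoalWith G′ Ws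

-- Instantiating by a solution ν of Π preserves CHL(C)-derivations: the side conditions
-- Π ⊨ c of (EA) and (PA) become ground constraints that are true at ν, hence entailed by Π.
-- Every variable of G″ outside var(G) is guarded by an atom qVal(X) of G″, and a derivation
-- of qVal(Xσ′) from Π must use the clause of E_D for qVal, so the specification of qval puts
-- Xσ′ν into the range of ι.

module Submission where

open import Defs
open import Data.List using (List)
open import Data.List.Membership.Propositional using (_∈_; _∉_)
open import Data.List.Relation.Unary.All using (All)
open import Data.Product using (∃; _×_; proj₁)
open import Relation.Binary.PropositionalEquality using (_≡_)

open import Data.Empty using (⊥; ⊥-elim)
open import Data.Fin using (Fin; zero; suc)
open import Data.List using ([]; _∷_; _++_; length)
open import Data.List.Properties using (++-assoc; ++-identityʳ)
open import Data.List.Membership.Propositional using (find)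
open import Data.List.Membership.Propositional.Properties
  using (∈-++⁻; ∈-++⁺ˡ; ∈-++⁺ʳ; ∈-map⁺; ∈-concatMap⁻)
open import Data.List.Relation.Unary.Any using (here; there)
open import Data.List.Relation.Unary.Any.Properties using (¬Any[])
import Data.List.Relation.Unary.All as All
open import Data.Maybe using (just; nothing)
open import Data.Nat using (ℕ)
open import Data.Product using (_,_; proj₂)
open import Data.Sum as Sum using (_⊎_; inj₁; inj₂)
open import Data.Vec using (Vec; []; _∷_; lookup; _∷ʳ_)
open import Function using (_∘_)
open import Function.Bundles using (Equivalence)
open import Relation.Binary.PropositionalEquality
  using (refl; sym; trans; cong; cong₂; subst; module ≡-Reasoning)

module Substitution (CD : ConstraintDomain) where
  open ConstraintDomain CD
  open Syntax CD

  mutual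
    ⟨⟩-assoc : ∀ {U V W} (t : TermOver BV DC U)
               (f : U → TermOver BV DC V) (g : V → TermOver BV DC W) →
               t ⟨ f ⟩ ⟨ g ⟩ ≡ t ⟨ (λ y → f y ⟨ g ⟩) ⟩
    ⟨⟩-assoc (var x)    f g = refl
    ⟨⟩-assoc (val u)    f g = refl
    ⟨⟩-assoc (con c ts) f g = cong (con c) (⟨⟩*-assoc ts f g)

    ⟨⟩*-assoc : ∀ {U V W n} (ts : Vec (TermOver BV DC U) n)
                (f : U → TermOver BV DC V) (g : V → TermOver BV DC W) →
                ts ⟨ f ⟩* ⟨ g ⟩* ≡ ts ⟨ (λ y → f y ⟨ g ⟩) ⟩*
    ⟨⟩*-assoc []       f g = refl
    ⟨⟩*-assoc (t ∷ ts) f g = cong₂ _∷_ (⟨⟩-assoc t f g) (⟨⟩*-assoc ts f g)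

  mutual
    ⟨⟩-cong : ∀ {U V} (t : TermOver BV DC U) {f g : U → TermOver BV DC V} →
              (∀ y → f y ≡ g y) → t ⟨ f ⟩ ≡ t ⟨ g ⟩
    ⟨⟩-cong (var x)    f≗g = f≗g x
    ⟨⟩-cong (val u)    f≗g = refl
    ⟨⟩-cong (con c ts) f≗g = cong (con c) (⟨⟩*-cong ts f≗g)

    ⟨⟩*-cong : ∀ {U V n} (ts : Vec (TermOver BV DC U) n) {f g : U → TermOver BV DC V} →
               (∀ y → f y ≡ g y) → ts ⟨ f ⟩* ≡ ts ⟨ g ⟩*
    ⟨⟩*-cong []       f≗g = refl
    ⟨⟩*-cong (t ∷ ts) f≗g = cong₂ _∷_ (⟨⟩-cong t f≗g) (⟨⟩*-cong ts f≗g)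

  mutual
    ⟨⟩-ground : (t : GTerm) (h : ⊥ → GTerm) → t ⟨ h ⟩ ≡ t
    ⟨⟩-ground (val u)    h = refl
    ⟨⟩-ground (con c ts) h = cong (con c) (⟨⟩*-ground ts h)

    ⟨⟩*-ground : ∀ {n} (ts : Vec GTerm n) (h : ⊥ → GTerm) → ts ⟨ h ⟩* ≡ ts
    ⟨⟩*-ground []       h = refl
    ⟨⟩*-ground (t ∷ ts) h = cong₂ _∷_ (⟨⟩-ground t h) (⟨⟩*-ground ts h)

  mutual
    varsT-⌜⌝ : (t : GTerm) → varsT ⌜ t ⌝ ≡ []
    varsT-⌜⌝ (val u)    = refl
    varsT-⌜⌝ (con c ts) = varsT*-⌜⌝ ts

    varsT*-⌜⌝ : ∀ {n} (ts : Vec GTerm n) → varsT* (ts ⟨ ⊥-elim ⟩*) ≡ []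
    varsT*-⌜⌝ []       = refl
    varsT*-⌜⌝ (t ∷ ts) = cong₂ _++_ (varsT-⌜⌝ t) (varsT*-⌜⌝ ts)

  ∉-varsT-⌜⌝ : ∀ (t : GTerm) {x} → x ∉ varsT ⌜ t ⌝
  ∉-varsT-⌜⌝ t x∈ = ¬Any[] (subst (_ ∈_) (varsT-⌜⌝ t) x∈)

  varsT*-∷ʳ : ∀ {n} (ts : Vec Term n) (t : Term) → varsT* (ts ∷ʳ t) ≡ varsT* ts ++ varsT t
  varsT*-∷ʳ []       t = ++-identityʳ (varsT t)
  varsT*-∷ʳ (u ∷ ts) t = trans (cong (varsT u ++_) (varsT*-∷ʳ ts t)) (sym (++-assoc (varsT u) _ _))

  lookup-⟨⟩* : ∀ {n} (ts : Vec Term n) (σ : Subst) (i : Fin n) →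
               lookup (ts ⟨ σ ⟩*) i ≡ lookup ts i ⟨ σ ⟩
  lookup-⟨⟩* (t ∷ ts) σ zero    = refl
  lookup-⟨⟩* (t ∷ ts) σ (suc i) = lookup-⟨⟩* ts σ i

  ⟨var·⟩ : ∀ (t : Term) ν → t ⟨ var · ν ⟩ ≡ ⌜ t ⟨ ν ⟩ ⌝
  ⟨var·⟩ t ν = sym (⟨⟩-assoc t ν ⊥-elim)

  ⌜⌝-⟨⟩ : ∀ (g : GTerm) η → ⌜ g ⌝ ⟨ η ⟩ ≡ g
  ⌜⌝-⟨⟩ g η = trans (⟨⟩-assoc g ⊥-elim η) (⟨⟩-ground g _)

  substA-assoc : ∀ {Pr} (A : Atom Pr) (f g : Subst) →
                 substA g (substA f A) ≡ substA (λ y → f y ⟨ g ⟩) A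
  substA-assoc (def p ts)       f g = cong (def p) (⟨⟩*-assoc ts f g)
  substA-assoc (cn (prim r ts)) f g = cong (cn ∘ prim r) (⟨⟩*-assoc ts f g)
  substA-assoc (cn (t == s))    f g = cong₂ (λ t′ s′ → cn (t′ == s′)) (⟨⟩-assoc t f g) (⟨⟩-assoc s f g)

  substA-cong : ∀ {Pr} (A : Atom Pr) {f g : Subst} → (∀ y → f y ≡ g y) → substA f A ≡ substA g A
  substA-cong (def p ts)       f≗g = cong (def p) (⟨⟩*-cong ts f≗g)
  substA-cong (cn (prim r ts)) f≗g = cong (cn ∘ prim r) (⟨⟩*-cong ts f≗g)
  substA-cong (cn (t == s))    f≗g = cong₂ (λ t′ s′ → cn (t′ == s′)) (⟨⟩-cong t f≗g) (⟨⟩-cong s f≗g)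

  substA-var· : ∀ {Pr} (A : Atom Pr) σ ν → substA (var · ν) (substA σ A) ≡ substA (σ · ν) A
  substA-var· A σ ν = trans (substA-assoc A σ (var · ν)) (substA-cong A (λ y → ⟨var·⟩ (σ y) ν))

  holds-substC : ∀ c θ ν → holds (substC θ c) ν → holds c (λ y → θ y ⟨ ν ⟩)
  holds-substC (prim r ts) θ ν = subst (interp r) (⟨⟩*-assoc ts θ ν)
  holds-substC (t == s)    θ ν h = trans (sym (⟨⟩-assoc t θ ν)) (trans h (⟨⟩-assoc s θ ν))

  holds-instantiate : ∀ c ν η → holds c ν → holds (substC (var · ν) c) η
  holds-instantiate (prim r ts) ν η = subst (interp r) (sym (begin
      ts ⟨ var · ν ⟩* ⟨ η ⟩*                  ≡⟨ ⟨⟩*-assoc ts (var · ν) η ⟩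
      ts ⟨ (λ y → ⌜ ν y ⌝ ⟨ η ⟩) ⟩*           ≡⟨ ⟨⟩*-cong ts (λ y → ⌜⌝-⟨⟩ (ν y) η) ⟩
      ts ⟨ ν ⟩*                               ∎))
    where open ≡-Reasoning
  holds-instantiate (t == s) ν η h = begin
      t ⟨ var · ν ⟩ ⟨ η ⟩   ≡⟨ cong (_⟨ η ⟩) (⟨var·⟩ t ν) ⟩
      ⌜ t ⟨ ν ⟩ ⌝ ⟨ η ⟩     ≡⟨ ⌜⌝-⟨⟩ _ η ⟩
      t ⟨ ν ⟩               ≡⟨ h ⟩
      s ⟨ ν ⟩               ≡⟨ sym (⌜⌝-⟨⟩ _ η) ⟩
      ⌜ s ⟨ ν ⟩ ⌝ ⟨ η ⟩     ≡⟨ cong (_⟨ η ⟩) (⟨var·⟩ s ν) ⟨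
      s ⟨ var · ν ⟩ ⟨ η ⟩   ∎
    where open ≡-Reasoning

  Derives-⊨ : ∀ {Pr} {Prog : Clause Pr → Set} {c Π} → Derives Prog (cn c) Π → Π ⊨ c
  Derives-⊨ (EA Π⊨c) = Π⊨c
  Derives-⊨ (PA Π⊨c) = Π⊨c

  Derives-instantiate : ∀ {Pr} {Prog : Clause Pr → Set} {A Π} ν → SolC Π ν →
                        Derives Prog A Π → Derives Prog (substA (var · ν) A) Π
  Derives-instantiate {Prog = Prog} {Π = Π} ν ν∈Π (DA C C∈P θ ts′ heads body) =
    DA C C∈P (λ y → θ y ⟨ var · ν ⟩) (ts′ ⟨ var · ν ⟩*)
      (λ i → subst (λ A → Derives Prog A Π)
                   (cong₂ (λ t s → cn (t == s)) (sym (lookup-⟨⟩* ts′ (var · ν) i))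
                                                 (⟨⟩-assoc (lookup (Clause.args C) i) θ (var · ν)))
                   (Derives-instantiate ν ν∈Π (heads i)))
      (λ B B∈ → subst (λ A → Derives Prog A Π) (substA-assoc B θ (var · ν))
                      (Derives-instantiate ν ν∈Π (body B B∈)))
  Derives-instantiate ν ν∈Π (EA {t = t} {s} Π⊨c) =
    EA (λ η _ → holds-instantiate (t == s) ν η (Π⊨c ν ν∈Π))
  Derives-instantiate ν ν∈Π (PA {r = r} {ts} Π⊨c) =
    PA (λ η _ → holds-instantiate (prim r ts) ν η (Π⊨c ν ν∈Π))

  SolP-instantiate : ∀ {Pr} {Prog : Clause Pr → Set} {G σ Π} ν → SolC Π ν →
                     SolP Prog G σ Π → SolP Prog G (σ · ν) Π
  SolP-instantiate {Prog = Prog} {σ = σ} {Π} ν ν∈Π (sat , derivs) =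
    sat , All.map (λ {A} d → subst (λ A′ → Derives Prog A′ Π) (substA-var· A σ ν)
                                   (Derives-instantiate ν ν∈Π d)) derivs

module Elimination (CD : ConstraintDomain) (QD : QualDomain) where
  open ConstraintDomain CD
  open Syntax CD
  open Theory CD QD
  open Substitution CD

  varsA-∼A : (B : Atom DP) → varsA (B ∼A) ≡ varsA B
  varsA-∼A (def p ts)       = refl
  varsA-∼A (cn (prim r ts)) = refl
  varsA-∼A (cn (t == s))    = cong (varsT t ++_) (++-identityʳ (varsT s))

  dataVarsG-elimSGoal : (G : QGoal DP) → dataVarsG (elimSGoal G) ≡ dataVarsG G
  dataVarsG-elimSGoal []            = refl
  dataVarsG-elimSGoal ((B , _) ∷ G) = cong₂ _++_ (varsA-∼A B) (dataVarsG-elimSGoal G)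

  module _ (E : ExistExpressible) where
    open ElimD E
    open ExistExpressible E

    qVal-sound : ∀ {Pr} {P′ : QClause Pr → Set} {t Π} → Derives (ElimD P′) (qValA t) Π →
                 ∀ ν → SolC Π ν → ∃ λ d → t ⟨ ν ⟩ ≡ ι d
    qVal-sound (DA _ eD-qVal θ (t ∷ []) heads body) ν ν∈Π =
      let η = λ y → θ y ⟨ ν ⟩
          η⊨body : SolC qvalBody η
          η⊨body = All.tabulate (λ {c} c∈ → holds-substC c θ ν
                     (Derives-⊨ (body (cn c) (∈-map⁺ cn c∈)) ν ν∈Π))
          d , ηX≡ιd = Equivalence.to (qvalSpec η) (η , refl , η⊨body)
      in d , trans (Derives-⊨ (heads zero) ν ν∈Π) ηX≡ιd

    ∈-++[]⁻ : ∀ {x} (xs : List ℕ) → x ∈ xs ++ [] → x ∈ xs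
    ∈-++[]⁻ xs = subst (_ ∈_) (++-identityʳ xs)

    qBoundA-vars : ∀ {Pr} (t₁ t₂ t₃ : Term) {x} → x ∈ varsA (qBoundA {Pr} t₁ t₂ t₃) →
                   x ∈ varsT t₁ ⊎ x ∈ varsT t₂ ⊎ x ∈ varsT t₃
    qBoundA-vars t₁ t₂ t₃ x∈ =
      Sum.map₂ (Sum.map₂ (∈-++[]⁻ (varsT t₃)) ∘ ∈-++⁻ (varsT t₂)) (∈-++⁻ (varsT t₁) x∈)
    τ-vars : ∀ {Pr} (B : Atom Pr) w {x} → x ∈ varsA (proj₁ (τ B w)) →
             x ∈ varsA B ⊎ x ∈ varsT (proj₂ (τ B w))
    τ-vars (def p ts) w x∈ = ∈-++⁻ (varsT* ts) (subst (_ ∈_) (varsT*-∷ʳ ts (var w)) x∈)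
    τ-vars (cn c)     w x∈ = inj₁ x∈

    τ-weight-var : ∀ {Pr} (B : Atom Pr) w {x} → x ∈ varsT (proj₂ (τ B w)) → proj₂ (τ B w) ≡ var x
    τ-weight-var (def p ts) w (here refl) = refl
    τ-weight-var (cn c)     w x∈          = ⊥-elim (∉-varsT-⌜⌝ (ι 𝐭*) x∈)

    τGoalAtom-vars : ∀ {Pr} (B : Atom Pr) W β w {A x} →
                     A ∈ τGoalAtom ((B , W , β) , w) → x ∈ varsA A →
                     x ∈ varsA B ⊎ qValA (var x) ∈ τGoalAtom ((B , W , β) , w)
    τGoalAtom-vars {Pr} B W β w = from-block β
      where
        w′ = proj₂ (τ B w)

        Block : D? → List (Atom (Ext Pr))
        Block β = τGoalAtom ((B , W , β) , w)

        Tail : List (Atom (Ext Pr))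
        Tail = qValA w′ ∷ qBoundA (var W) ιt w′ ∷ proj₁ (τ B w) ∷ []

        Tail⊆Block : ∀ β {A} → A ∈ Tail → A ∈ Block β
        Tail⊆Block nothing  = there
        Tail⊆Block (just d) = there ∘ there

        w′-guarded : ∀ β {x} → x ∈ varsT w′ → qValA (var x) ∈ Block β
        w′-guarded β x∈ = subst (λ t → qValA t ∈ Block β) (τ-weight-var B w x∈)
                                (Tail⊆Block β (here refl))

        from-tail : ∀ β {A x} → A ∈ Tail → x ∈ varsA A → x ∈ varsA B ⊎ qValA (var x) ∈ Block β
        from-tail β (here refl) x∈ = inj₂ (w′-guarded β (∈-++[]⁻ (varsT w′) x∈))
        from-tail β (there (here refl)) x∈ with qBoundA-vars {Pr} (var W) ιt w′ x∈
        ... | inj₁ (here refl)  = inj₂ (here refl)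
        ... | inj₂ (inj₁ x∈ιt) = ⊥-elim (∉-varsT-⌜⌝ (ι 𝐭*) x∈ιt)
        ... | inj₂ (inj₂ x∈w′) = inj₂ (w′-guarded β x∈w′)
        from-tail β (there (there (here refl))) x∈ = Sum.map₂ (w′-guarded β) (τ-vars B w x∈)

        from-block : ∀ β {A x} → A ∈ Block β → x ∈ varsA A → x ∈ varsA B ⊎ qValA (var x) ∈ Block β
        from-block β        (here refl) (here refl) = inj₂ (here refl)
        from-block nothing  (there A∈)             = from-tail nothing A∈
        from-block (just d) (there (there A∈))     = from-tail (just d) A∈
        from-block (just d) (there (here refl)) x∈ with qBoundA-vars {Pr} ⌜ ι d ⌝ ιt (var W) x∈
        ... | inj₁ x∈ιd                = ⊥-elim (∉-varsT-⌜⌝ (ι d) x∈ιd)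
        ... | inj₂ (inj₁ x∈ιt)         = ⊥-elim (∉-varsT-⌜⌝ (ι 𝐭*) x∈ιt)
        ... | inj₂ (inj₂ (here refl)) = inj₂ (here refl)

    elimDGoalWith-vars : ∀ {Pr} (G : QGoal Pr) (Ws : Vec ℕ (length G)) {A x} →
                         A ∈ elimDGoalWith G Ws → x ∈ varsA A →
                         x ∈ dataVarsG G ⊎ qValA (var x) ∈ elimDGoalWith G Ws
    elimDGoalWith-vars ((B , W , β) ∷ G) (w ∷ Ws) A∈ x∈A
      with ∈-++⁻ (τGoalAtom ((B , W , β) , w)) A∈
    ... | inj₁ A∈block = Sum.map ∈-++⁺ˡ ∈-++⁺ˡ (τGoalAtom-vars B W β w A∈block x∈A)
    ... | inj₂ A∈rest  = Sum.map (∈-++⁺ʳ (varsA B)) (∈-++⁺ʳ (τGoalAtom ((B , W , β) , w)))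
                                 (elimDGoalWith-vars G Ws A∈rest x∈A)

    qVal-guarded : ∀ {Pr} {P′ : QClause Pr → Set} {G σ Π X} →
                   SolP (ElimD P′) G σ Π → qValA (var X) ∈ G →
                   ∀ ν → SolC Π ν → ∃ λ d → (σ · ν) X ≡ ⌜ ι d ⌝
    qVal-guarded (_ , derivs) guard ν ν∈Π =
      let d , σXν≡ιd = qVal-sound (All.lookup derivs guard) ν ν∈Π in d , cong ⌜_⌝ σXν≡ιd

lemma4p3 : (CD : ConstraintDomain) (QD : QualDomain) →
    let open Syntax CD
        open Theory CD QD
    in (S : Admissible) (E : ExistExpressible) →
       let open ElimS S
           open ElimD E
           open ExistExpressible E
       in (P : List (QClause (ConstraintDomain.DP CD))) (G : QGoal (ConstraintDomain.DP CD)) →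
          WellFormedGoal G →
          All (λ g → Relevant P (proj₁ g)) G →
          (G″ : CGoal (Ext DP′)) → IsElimDGoal (elimSGoal G) G″ →
          (σ′ : Subst) (Π : List ACon) →
          SolP (ElimD (ElimS P)) G″ σ′ Π →
          (ν : Valuation) → SolC Π ν →
          SolP (ElimD (ElimS P)) G″ (σ′ · ν) Π
          × (∀ W → W ∈ varsCGoal G″ → W ∉ dataVarsG G → ∃ λ d → (σ′ · ν) W ≡ ⌜ ι d ⌝)
lemma4p3 CD QD S E P G _ _ ._ (Ws , _ , _ , refl) σ′ Π sol ν ν∈Π =
  Substitution.SolP-instantiate CD ν ν∈Π sol , qualification-vars
  where
    open Syntax CD
    open Theory CD QD
    open ElimD E
    open ExistExpressible E
    open Elimination CD QD

    qualification-vars : ∀ X → X ∈ varsCGoal (elimDGoalWith (elimSGoal G) Ws) → X ∉ dataVarsG G →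
                         ∃ λ d → (σ′ · ν) X ≡ ⌜ ι d ⌝
    qualification-vars X X∈G″ X∉G with find (∈-concatMap⁻ varsA X∈G″)
    ... | A , A∈G″ , X∈A with elimDGoalWith-vars E (elimSGoal G) Ws A∈G″ X∈A
    ...   | inj₁ X∈G = ⊥-elim (X∉G (subst (X ∈_) (dataVarsG-elimSGoal G) X∈G))
    ...   | inj₂ qValX∈G″ = qVal-guarded E sol qValX∈G″ ν ν∈Π
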